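{- Let $r\ge2$. Let $\ell\ge0$ and $k\ge(r-1)\ell$ be integers, $u,n$ positive integers, and $0<\varepsilon\le1$ with $(1-\varepsilon)^{\ell}n\le u$. Let $G$ be an $r$-uniform hypergraph on $n$ vertices such that for every vertex subset $S$ with $|S|>u$, the induced subhypergraph $G[S]$ has maximum degree at least $\varepsilon(|S|-1)^{r-1}$. Then the number of independent sets of order $k$ in $G$ is at most $\binom{n}{(r-1)\ell}\binom{u}{k-(r-1)\ell}$.
   Context: The degree of a vertex in an $r$-uniform hypergraph is the number of edges containing it. An independent set is a vertex set containing no edge. $G[S]$ is the hypergraph on $S$ whose edges are the edges of $G$ contained in $S$.
   Formalization: The parameter ε ranges over the rationals with $0<\varepsilon\le1$. -}

module Defs where

open import Data.Bool using (Bool; true; false; _∧_; not; T)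
open import Data.Nat using (ℕ; zero; suc; _⊔_)
open import Data.Fin using (Fin)
open import Data.Fin.Subset using (Subset; inside; outside; _⊆_; _∈_; ∣_∣)
open import Data.Fin.Subset.Properties using (_⊆?_; _∈?_)
open import Data.List using (List; []; _∷_; map; _++_; length; filter; allFin; foldr)
open import Data.Vec using (_∷_; [])
open import Data.Integer using (+_)
open import Data.Rational using (ℚ; 1ℚ; _*_; _/_)
open import Relation.Binary.PropositionalEquality using (_≡_)
open import Relation.Nullary using (⌊_⌋)
open import Relation.Nullary.Decidable using (does)
open import Data.Nat using (_≟_)

allSubsets : (n : ℕ) → List (Subset n)
allSubsets zero = [] ∷ []
allSubsets (suc n) = map (outside ∷_) (allSubsets n) ++ map (inside ∷_) (allSubsets n)

record Hypergraph (r n : ℕ) : Set where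
  field
    isEdge  : Subset n → Bool
    uniform : ∀ e → T (isEdge e) → ∣ e ∣ ≡ r
open Hypergraph public

degreeIn : ∀ {r n} → Hypergraph r n → Subset n → Fin n → ℕ
degreeIn {n = n} G S v =
  length (filter (λ e → T? (isEdge G e ∧ (⌊ e ⊆? S ⌋ ∧ ⌊ v ∈? e ⌋))) (allSubsets n))
  where
  open import Data.Bool.Properties using () renaming (T? to T?)

-- maximum degree of G[S] (vertices outside S have degree 0 in G[S],
-- so maximising over all vertices equals maximising over S; 0 if S empty)
maxDegreeIn : ∀ {r n} → Hypergraph r n → Subset n → ℕ
maxDegreeIn {n = n} G S = foldr _⊔_ 0 (map (degreeIn G S) (allFin n))

independentᵇ : ∀ {r n} → Hypergraph r n → Subset n → Bool
independentᵇ {n = n} G I = foldr (λ e b → not (isEdge G e ∧ ⌊ e ⊆? I ⌋) ∧ b) true (allSubsets n)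

numIndependent : ∀ {r n} → Hypergraph r n → ℕ → ℕ
numIndependent {n = n} G k =
  length (filter (λ I → T? (independentᵇ G I ∧ ⌊ ∣ I ∣ ≟ k ⌋)) (allSubsets n))
  where
  open import Data.Bool.Properties using () renaming (T? to T?)

ℕtoℚ : ℕ → ℚ
ℕtoℚ m = + m / 1

_^ℚ_ : ℚ → ℕ → ℚ
q ^ℚ zero = 1ℚ
q ^ℚ suc m = q * (q ^ℚ m)

module Submission where

-- For S with (1 - ε)^ℓ |S| ≤ u we bound the number of independent k-subsets of S by
-- C(|S|, t) C(u, k - t) for every t with (r - 1) ℓ ≤ t ≤ k, by induction on ℓ and then on S.
-- If |S| ≤ u this is C(|S|, k) ≤ C(|S|, t) C(u, k - t). Otherwise a vertex v of maximum degree in G[S]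
-- has degree at least ε (|S| - 1)^(r - 1). The sets avoiding v are counted inside S - v, and a set
-- containing v becomes, once v is removed, independent both in G and in the link of v in G[S], an
-- (r - 1)-uniform hypergraph on m = |S| - 1 vertices with at least ε m^(r - 1) edges.
-- Call a j-uniform H on m vertices dense if it has at least ε m^j edges, and a vertex heavy if its
-- H-degree is at least ε m^(j - 1). Double counting shows that at least ε m vertices are heavy, and the
-- link of a heavy vertex is again dense. So while the ground set R contains a heavy vertex we split on
-- it once more, the sets containing it passing to its link; once R contains none, |R| ≤ (1 - ε) m and the
-- bound for ℓ - 1 applies. A dense 0-uniform hypergraph has the empty set as an edge, so no independent
-- sets, which ends the descent through links. Every split is a step of Pascal's rule.

open import Defs
open import Data.Nat using (ℕ; _≤_; _<_; _∸_; _*_)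
open import Data.Nat.Combinatorics using (_C_)
open import Data.Fin.Subset using (Subset; ∣_∣)
open import Data.Rational using (ℚ; 0ℚ; 1ℚ; _-_) renaming (_≤_ to _≤ℚ_; _<_ to _<ℚ_; _*_ to _*ℚ_)

open import Level using (Level)
open import Function using (_∘_; _⇔_; Equivalence; mk⇔)
open import Data.Bool using (Bool; true; false; _∧_; not; T; if_then_else_)
open import Data.Bool.Properties using (T?; T-∧; ∧-assoc)
open import Data.Product using (_×_; _,_; proj₁; proj₂; ∃)
import Data.Product as Product
open import Data.Sum using (_⊎_; inj₁; inj₂; [_,_]′)
import Data.Sum as Sum
open import Relation.Binary.PropositionalEquality
open import Relation.Nullary using (Dec; yes; no; does; ⌊_⌋; ¬_; _×-dec_; ¬?; contradiction)
open import Relation.Nullary.Decidable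
  using (dec-true; dec-false; isYes≗does; map′; toWitness; fromWitness; toWitnessFalse; fromWitnessFalse)
open import Relation.Unary using (Pred; Decidable)

open import Data.Nat using (zero; suc; _+_; _^_; _⊔_; z≤n; s≤s; _≟_; _≤?_; ≤′-refl; ≤′-step; NonZero; >-nonZero)
open import Data.Nat.Properties
open import Data.Nat.Combinatorics using (nCk+nC[k+1]≡[n+1]C[k+1])
open import Data.Nat.Solver using (module +-*-Solver)
open import Algebra.Properties.CommutativeSemigroup +-commutativeSemigroup
  using () renaming (interchange to +-interchange)
open import Algebra.Properties.CommutativeSemigroup *-commutativeSemigroup
  using () renaming (x∙yz≈y∙xz to x*[y*z]≡y*[x*z])
open import Algebra.Properties.Semiring.Sum +-*-semiring using (sum; ∑-distrib-+; *-distribˡ-sum; sum-replicate-zero)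

open import Data.Fin using (Fin; zero; suc)
open import Data.Fin.Properties using (any?)
open import Data.Fin.Subset using (⊤; inside; outside; _∈_; _∉_; _⊆_; _⊂_; _⊈_; _∪_; _─_; ⁅_⁆)
open import Data.Fin.Subset.Properties
  using (_∈?_; _⊆?_; anySubset?; ⊆⊤; ∣⊤∣≡n; ∪-identityʳ; x∈p⇒p-x⊂p; p⊂q⇒p⊆q; p⊆q⇒∣p∣≤∣q∣; drop-not-there; p─⊥≡p;
         x∈p∧x≢y⇒x∈p-y; p⊆p∪q; x∈p∪q⁺; x∈p∪q⁻)
open import Data.Fin.Subset.Induction using (Acc; acc; ⊂-wellFounded)
open import Data.Vec using (_∷_; []; here; there)
open import Data.List as List using (List; map; _++_; length; filter; allFin)
import Data.List.Properties as Listₚ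
open import Data.List.Membership.Propositional using () renaming (_∈_ to _∈ˡ_)
open import Data.List.Membership.Propositional.Properties using (∈-map⁺; ∈-++⁺ˡ; ∈-++⁺ʳ)
import Data.List.Relation.Unary.Any as Any

open import Data.Nat.Coprimality using (1-coprimeTo) renaming (sym to coprime-sym)
import Data.Integer as ℤ
import Data.Integer.Properties as ℤₚ
open import Data.Rational using (mkℚ; *≤*; *<*; NonNegative; toℚᵘ) renaming (_+_ to _+ℚ_)
open import Data.Rational.Properties
  using (normalize-coprime; toℚᵘ-injective; toℚᵘ-homo-*; toℚᵘ-homo-+; *-monoʳ-≤-nonNeg)
import Data.Rational.Unnormalised as ℚᵘ
import Data.Rational.Unnormalised.Properties as ℚᵘₚ
import Data.Rational.Solver as ℚ-Solver

private variable
  a b : Level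
  j n m r : ℕ
  A : Set a

𝟙 : Dec A → ℕ
𝟙 d = if does d then 1 else 0

𝟙-yes : (d : Dec A) → A → 𝟙 d ≡ 1
𝟙-yes d a = cong (λ b → if b then 1 else 0) (dec-true d a)

𝟙-no : (d : Dec A) → ¬ A → 𝟙 d ≡ 0
𝟙-no d ¬a = cong (λ b → if b then 1 else 0) (dec-false d ¬a)

𝟙-disjoint : ∀ {b c} {B : Set b} {C : Set c} (a? : Dec A) (b? : Dec B) (c? : Dec C) →
             (A → C) → (B → C) → (A → ¬ B) → 𝟙 a? + 𝟙 b? ≤ 𝟙 c?
𝟙-disjoint a? b? c? A⇒C B⇒C A⇒¬B with a? | b? | c?
... | yes a | yes b | _     = contradiction b (A⇒¬B a)
... | yes a | no _  | no ¬c = contradiction (A⇒C a) ¬c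
... | no _  | yes b | no ¬c = contradiction (B⇒C b) ¬c
... | yes _ | no _  | yes _ = ≤-refl
... | no _  | yes _ | yes _ = ≤-refl
... | no _  | no _  | _     = z≤n

∑-mono-≤ : {f g : Fin n → ℕ} → (∀ i → f i ≤ g i) → sum f ≤ sum g
∑-mono-≤ {zero}  f≤g = z≤n
∑-mono-≤ {suc n} f≤g = +-mono-≤ (f≤g zero) (∑-mono-≤ (f≤g ∘ suc))

∑ˢ : (Subset n → ℕ) → ℕ
∑ˢ {zero}  f = f []
∑ˢ {suc n} f = ∑ˢ (f ∘ (outside ∷_)) + ∑ˢ (f ∘ (inside ∷_))

∑ˢ-cong : {f g : Subset n → ℕ} → (∀ I → f I ≡ g I) → ∑ˢ f ≡ ∑ˢ g
∑ˢ-cong {zero}  f≗g = f≗g []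
∑ˢ-cong {suc n} f≗g = cong₂ _+_ (∑ˢ-cong (f≗g ∘ (outside ∷_))) (∑ˢ-cong (f≗g ∘ (inside ∷_)))

∑ˢ-mono-≤ : {f g : Subset n → ℕ} → (∀ I → f I ≤ g I) → ∑ˢ f ≤ ∑ˢ g
∑ˢ-mono-≤ {zero}  f≤g = f≤g []
∑ˢ-mono-≤ {suc n} f≤g = +-mono-≤ (∑ˢ-mono-≤ (f≤g ∘ (outside ∷_))) (∑ˢ-mono-≤ (f≤g ∘ (inside ∷_)))

∑ˢ-distrib-+ : (f g : Subset n → ℕ) → ∑ˢ (λ I → f I + g I) ≡ ∑ˢ f + ∑ˢ g
∑ˢ-distrib-+ {zero}  f g = refl
∑ˢ-distrib-+ {suc n} f g =
  trans (cong₂ _+_ (∑ˢ-distrib-+ (f ∘ (outside ∷_)) (g ∘ (outside ∷_)))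
                   (∑ˢ-distrib-+ (f ∘ (inside ∷_)) (g ∘ (inside ∷_))))
        (+-interchange (∑ˢ (f ∘ (outside ∷_))) (∑ˢ (g ∘ (outside ∷_))) (∑ˢ (f ∘ (inside ∷_))) (∑ˢ (g ∘ (inside ∷_))))

∑ˢ-distribˡ-* : ∀ c (f : Subset n → ℕ) → ∑ˢ (λ I → c * f I) ≡ c * ∑ˢ f
∑ˢ-distribˡ-* {zero}  c f = refl
∑ˢ-distribˡ-* {suc n} c f =
  trans (cong₂ _+_ (∑ˢ-distribˡ-* c (f ∘ (outside ∷_))) (∑ˢ-distribˡ-* c (f ∘ (inside ∷_))))
        (sym (*-distribˡ-+ c (∑ˢ (f ∘ (outside ∷_))) (∑ˢ (f ∘ (inside ∷_)))))

∑ˢ-∑-comm : (f : Fin m → Subset n → ℕ) → ∑ˢ (λ I → sum (λ v → f v I)) ≡ sum (λ v → ∑ˢ (f v))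
∑ˢ-∑-comm {n = zero}  f = refl
∑ˢ-∑-comm {n = suc n} f =
  trans (cong₂ _+_ (∑ˢ-∑-comm (λ v → f v ∘ (outside ∷_))) (∑ˢ-∑-comm (λ v → f v ∘ (inside ∷_))))
        (sym (∑-distrib-+ (λ v → ∑ˢ (f v ∘ (outside ∷_))) (λ v → ∑ˢ (f v ∘ (inside ∷_)))))

∑ˢ-zero : ∑ˢ {n} (λ _ → 0) ≡ 0
∑ˢ-zero {zero}  = refl
∑ˢ-zero {suc n} = cong₂ _+_ (∑ˢ-zero {n}) (∑ˢ-zero {n})

count : {P : Pred (Subset n) a} → Decidable P → ℕ
count P? = ∑ˢ (λ I → 𝟙 (P? I))

count-mono : {P : Pred (Subset n) a} {Q : Pred (Subset n) b} (P? : Decidable P) (Q? : Decidable Q) →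
             (∀ {I} → P I → Q I) → count P? ≤ count Q?
count-mono P? Q? P⊆Q = ∑ˢ-mono-≤ 𝟙-mono
  where
  𝟙-mono : ∀ I → 𝟙 (P? I) ≤ 𝟙 (Q? I)
  𝟙-mono I with P? I | Q? I
  ... | yes p | no ¬q = contradiction (P⊆Q p) ¬q
  ... | yes _ | yes _ = ≤-refl
  ... | no _  | _     = z≤n

module _ {P : Pred (Subset n) a} {Q : Pred (Subset n) b} where

  count-cong : (P? : Decidable P) (Q? : Decidable Q) → (∀ {I} → P I ⇔ Q I) → count P? ≡ count Q?
  count-cong P? Q? P⇔Q = ≤-antisym (count-mono P? Q? (Equivalence.to P⇔Q)) (count-mono Q? P? (Equivalence.from P⇔Q))

  count-split : (P? : Decidable P) (Q? : Decidable Q) →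
                count P? ≡ count (λ I → P? I ×-dec ¬? (Q? I)) + count (λ I → P? I ×-dec Q? I)
  count-split P? Q? =
    trans (∑ˢ-cong 𝟙-split) (∑ˢ-distrib-+ (λ I → 𝟙 (P? I ×-dec ¬? (Q? I))) (λ I → 𝟙 (P? I ×-dec Q? I)))
    where
    𝟙-split : ∀ I → 𝟙 (P? I) ≡ 𝟙 (P? I ×-dec ¬? (Q? I)) + 𝟙 (P? I ×-dec Q? I)
    𝟙-split I with does (P? I) | does (Q? I)
    ... | true  | true  = refl
    ... | true  | false = refl
    ... | false | _     = refl

module _ {P : Pred (Subset n) a} (P? : Decidable P) where

  count-empty : (∀ I → ¬ P I) → count P? ≡ 0
  count-empty ∄P = trans (∑ˢ-cong 𝟙-empty) (∑ˢ-zero {n})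
    where
    𝟙-empty : ∀ I → 𝟙 (P? I) ≡ 0
    𝟙-empty I with P? I
    ... | yes p = contradiction p (∄P I)
    ... | no _  = refl

  count-witness : 0 < count P? → ∃ P
  count-witness 0<count with anySubset? P?
  ... | yes ∃P = ∃P
  ... | no  ∄P = contradiction (count-empty (λ I p → ∄P (I , p))) (>⇒≢ 0<count)

count-∈ : ∀ {P : Pred (Subset n) a} (v : Fin n) (P? : Decidable P) →
          count (λ I → v ∈? I ×-dec P? I) ≡ count (λ I → ¬? (v ∈? I) ×-dec P? (I ∪ ⁅ v ⁆))
count-∈ {n = suc n} zero P? =
  trans (cong (_+ count (P? ∘ (inside ∷_))) (∑ˢ-zero {n}))
        (trans (+-comm 0 _)
               (cong₂ _+_ (∑ˢ-cong (λ I → cong (𝟙 ∘ P? ∘ (inside ∷_)) (sym (∪-identityʳ I))))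
                          (sym (∑ˢ-zero {n}))))
count-∈ {n = suc n} (suc v) P? =
  cong₂ _+_ (count-∈ v (P? ∘ (outside ∷_))) (count-∈ v (P? ∘ (inside ∷_)))

length-filter-map : ∀ {b} {B : Set b} {P : Pred A a} (P? : Decidable P) (f : B → A) xs →
                    length (filter P? (map f xs)) ≡ length (filter (P? ∘ f) xs)
length-filter-map P? f List.[]       = refl
length-filter-map P? f (x List.∷ xs) with does (P? (f x))
... | true  = cong suc (length-filter-map P? f xs)
... | false = length-filter-map P? f xs

length-filter-allSubsets : {P : Pred (Subset n) a} (P? : Decidable P) →
                           length (filter P? (allSubsets n)) ≡ count P?
length-filter-allSubsets {zero}  P? with does (P? [])
... | true  = refl
... | false = refl
length-filter-allSubsets {suc n} P? = begin
  length (filter P? (map (outside ∷_) (allSubsets n) ++ map (inside ∷_) (allSubsets n)))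
    ≡⟨ cong length (Listₚ.filter-++ P? (map (outside ∷_) (allSubsets n)) _) ⟩
  length (filter P? (map (outside ∷_) (allSubsets n)) ++ filter P? (map (inside ∷_) (allSubsets n)))
    ≡⟨ Listₚ.length-++ (filter P? (map (outside ∷_) (allSubsets n))) ⟩
  length (filter P? (map (outside ∷_) (allSubsets n))) + length (filter P? (map (inside ∷_) (allSubsets n)))
    ≡⟨ cong₂ _+_ (trans (length-filter-map P? (outside ∷_) (allSubsets n)) (length-filter-allSubsets (P? ∘ (outside ∷_))))
                 (trans (length-filter-map P? (inside ∷_) (allSubsets n)) (length-filter-allSubsets (P? ∘ (inside ∷_)))) ⟩
  count P? ∎
  where open ≡-Reasoning

pascal : ∀ n k → suc n C suc k ≡ n C k + n C suc k
pascal n k = sym (nCk+nC[k+1]≡[n+1]C[k+1] n k)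

nCk≤[1+n]Ck : ∀ n k → n C k ≤ suc n C k
nCk≤[1+n]Ck n zero    = ≤-refl
nCk≤[1+n]Ck n (suc k) = ≤-trans (m≤n+m (n C suc k) (n C k)) (≤-reflexive (sym (pascal n k)))

C-monoˡ-≤ : ∀ k → m ≤ n → m C k ≤ n C k
C-monoˡ-≤ {m} {n} k m≤n with ≤⇒≤′ m≤n
... | ≤′-refl       = ≤-refl
... | ≤′-step m≤′n = ≤-trans (C-monoˡ-≤ k (≤′⇒≤ m≤′n)) (nCk≤[1+n]Ck _ k)

nCk≤n^k : ∀ n k → n C k ≤ n ^ k
nCk≤n^k zero    zero    = ≤-refl
nCk≤n^k zero    (suc k) = z≤n
nCk≤n^k (suc n) zero    = ≤-refl
nCk≤n^k (suc n) (suc k) = begin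
  suc n C suc k           ≡⟨ pascal n k ⟩
  n C k + n C suc k       ≤⟨ +-mono-≤ (nCk≤n^k n k) (nCk≤n^k n (suc k)) ⟩
  n ^ k + n * n ^ k       ≡⟨⟩
  suc n * n ^ k           ≤⟨ *-monoʳ-≤ (suc n) (^-monoˡ-≤ k (n≤1+n n)) ⟩
  suc n * suc n ^ k       ∎
  where open ≤-Reasoning

sCk≤sCt*uC[k∸t] : ∀ {s u} t k → s ≤ u → t ≤ k → s C k ≤ (s C t) * (u C (k ∸ t))
sCk≤sCt*uC[k∸t] {s} zero k s≤u _ = ≤-trans (C-monoˡ-≤ k s≤u) (≤-reflexive (sym (+-identityʳ _)))
sCk≤sCt*uC[k∸t] {zero}  (suc t) (suc k) _ _ = z≤n
sCk≤sCt*uC[k∸t] {suc s} {u} (suc t) (suc k) 1+s≤u (s≤s t≤k) = begin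
  suc s C suc k                                          ≡⟨ pascal s k ⟩
  s C k + s C suc k                                      ≤⟨ +-mono-≤ (sCk≤sCt*uC[k∸t] t k s≤u t≤k)
                                                                     (sCk≤sCt*uC[k∸t] (suc t) (suc k) s≤u (s≤s t≤k)) ⟩
  (s C t) * (u C (k ∸ t)) + (s C suc t) * (u C (k ∸ t))  ≡⟨ sym (*-distribʳ-+ (u C (k ∸ t)) (s C t) (s C suc t)) ⟩
  (s C t + s C suc t) * (u C (k ∸ t))                    ≡⟨ cong (_* (u C (k ∸ t))) (sym (pascal s t)) ⟩
  (suc s C suc t) * (u C (k ∸ t))                        ∎
  where
  open ≤-Reasoning
  s≤u : s ≤ u
  s≤u = ≤-trans (n≤1+n s) 1+s≤u

pascal-≤ : ∀ a t c {x y} → x ≤ (a C suc t) * c → y ≤ (a C t) * c → x + y ≤ (suc a C suc t) * c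
pascal-≤ a t c {x} {y} x≤ y≤ = begin
  x + y                           ≤⟨ +-mono-≤ x≤ y≤ ⟩
  (a C suc t) * c + (a C t) * c   ≡⟨ sym (*-distribʳ-+ c (a C suc t) (a C t)) ⟩
  (a C suc t + a C t) * c         ≡⟨ cong (_* c) (trans (+-comm (a C suc t) (a C t)) (sym (pascal a t))) ⟩
  (suc a C suc t) * c             ∎
  where open ≤-Reasoning

count-subsets-of-size : (R : Subset n) (k : ℕ) → count (λ I → I ⊆? R ×-dec ∣ I ∣ ≟ k) ≡ ∣ R ∣ C k
count-subsets-of-size {zero} [] zero    = refl
count-subsets-of-size {zero} [] (suc k) = refl
count-subsets-of-size {suc n} (outside ∷ R) k =
  trans (cong₂ _+_ (count-subsets-of-size R k) (∑ˢ-zero {n})) (+-identityʳ _)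
count-subsets-of-size {suc n} (inside ∷ R) zero =
  cong₂ _+_ (count-subsets-of-size R zero) (count-empty (λ I → inside ∷ I ⊆? inside ∷ R ×-dec ∣ inside ∷ I ∣ ≟ 0) (λ _ ()))
count-subsets-of-size {suc n} (inside ∷ R) (suc k) =
  trans (cong₂ _+_ (count-subsets-of-size R (suc k)) (count-subsets-of-size R k))
        (trans (+-comm (∣ R ∣ C suc k) (∣ R ∣ C k)) (sym (pascal ∣ R ∣ k)))

∣p∣≡∑[x∈p] : (p : Subset n) → ∣ p ∣ ≡ sum (λ x → 𝟙 (x ∈? p))
∣p∣≡∑[x∈p] []            = refl
∣p∣≡∑[x∈p] (outside ∷ p) = ∣p∣≡∑[x∈p] p
∣p∣≡∑[x∈p] (inside ∷ p)  = cong suc (∣p∣≡∑[x∈p] p)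

∣p∪⁅x⁆∣≡1+∣p∣ : ∀ {x} {p : Subset n} → x ∉ p → ∣ p ∪ ⁅ x ⁆ ∣ ≡ suc ∣ p ∣
∣p∪⁅x⁆∣≡1+∣p∣ {x = zero}  {outside ∷ p} _   = cong suc (cong ∣_∣ (∪-identityʳ p))
∣p∪⁅x⁆∣≡1+∣p∣ {x = zero}  {inside ∷ p}  x∉p = contradiction here x∉p
∣p∪⁅x⁆∣≡1+∣p∣ {x = suc x} {outside ∷ p} x∉p = ∣p∪⁅x⁆∣≡1+∣p∣ (drop-not-there x∉p)
∣p∪⁅x⁆∣≡1+∣p∣ {x = suc x} {inside ∷ p}  x∉p = cong suc (∣p∪⁅x⁆∣≡1+∣p∣ (drop-not-there x∉p))

∣p∣≡1+∣p─⁅x⁆∣ : ∀ {x} {p : Subset n} → x ∈ p → ∣ p ∣ ≡ suc ∣ p ─ ⁅ x ⁆ ∣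
∣p∣≡1+∣p─⁅x⁆∣ {x = zero}  {inside ∷ p}  here        = cong suc (cong ∣_∣ (sym (p─⊥≡p p)))
∣p∣≡1+∣p─⁅x⁆∣ {x = suc x} {outside ∷ p} (there x∈p) = ∣p∣≡1+∣p─⁅x⁆∣ x∈p
∣p∣≡1+∣p─⁅x⁆∣ {x = suc x} {inside ∷ p}  (there x∈p) = cong suc (∣p∣≡1+∣p─⁅x⁆∣ x∈p)

p⊆q∧x∉p⇒p⊆q─⁅x⁆ : ∀ {x} {p q : Subset n} → p ⊆ q → x ∉ p → p ⊆ q ─ ⁅ x ⁆
p⊆q∧x∉p⇒p⊆q─⁅x⁆ p⊆q x∉p y∈p = x∈p∧x≢y⇒x∈p-y (p⊆q y∈p) (λ { refl → x∉p y∈p })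

p∪⁅x⁆⊆q⇒p⊆q : ∀ {x} {p q : Subset n} → p ∪ ⁅ x ⁆ ⊆ q → p ⊆ q
p∪⁅x⁆⊆q⇒p⊆q {x = x} p∪x⊆q = p∪x⊆q ∘ p⊆p∪q ⁅ x ⁆

p⊆q⇒p∪r⊆q∪r : ∀ {p q : Subset n} r → p ⊆ q → p ∪ r ⊆ q ∪ r
p⊆q⇒p∪r⊆q∪r {p = p} r p⊆q = x∈p∪q⁺ ∘ Sum.map₁ p⊆q ∘ x∈p∪q⁻ p r

∣p∣≡0⇒p⊆q : ∀ {p q : Subset n} → ∣ p ∣ ≡ 0 → p ⊆ q
∣p∣≡0⇒p⊆q ∣p∣≡0 x∈p = contradiction (trans (sym ∣p∣≡0) (∣p∣≡1+∣p─⁅x⁆∣ x∈p)) 0≢1+n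

allSubsets-complete : (p : Subset n) → p ∈ˡ allSubsets n
allSubsets-complete []            = Any.here refl
allSubsets-complete {suc n} (outside ∷ p) = ∈-++⁺ˡ (∈-map⁺ (outside ∷_) (allSubsets-complete p))
allSubsets-complete {suc n} (inside ∷ p)  =
  ∈-++⁺ʳ (map (outside ∷_) (allSubsets n)) (∈-map⁺ (inside ∷_) (allSubsets-complete p))

foldr-not-∧-sound : (f : A → Bool) (xs : List A) → T (List.foldr (λ x b → not (f x) ∧ b) true xs) →
                    ∀ {x} → x ∈ˡ xs → ¬ T (f x)
foldr-not-∧-sound f (x List.∷ xs) t (Any.here refl) fx with f x
... | true  = t
... | false = fx
foldr-not-∧-sound f (x List.∷ xs) t (Any.there x∈xs) with f x
... | true  = λ _ → t
... | false = foldr-not-∧-sound f xs t x∈xs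

foldr-not-∧-complete : (f : A → Bool) → (∀ x → ¬ T (f x)) →
                       ∀ xs → T (List.foldr (λ x b → not (f x) ∧ b) true xs)
foldr-not-∧-complete f ¬f List.[]        = _
foldr-not-∧-complete f ¬f (x List.∷ xs) with f x | ¬f x
... | true  | ¬fx = ¬fx _
... | false | _   = foldr-not-∧-complete f ¬f xs

Independent : Hypergraph r n → Subset n → Set
Independent H I = ∀ {e} → T (isEdge H e) → e ⊈ I

independentᵇ⇔Independent : (H : Hypergraph r n) (I : Subset n) → T (independentᵇ H I) ⇔ Independent H I
independentᵇ⇔Independent {n = n} H I = mk⇔
  (λ t {e} edge e⊆I → foldr-not-∧-sound edgeInside (allSubsets n) t (allSubsets-complete e)
                    (Equivalence.from T-∧ (edge , fromWitness e⊆I)))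
  (λ indep → foldr-not-∧-complete edgeInside
               (λ e t → let (edge , e⊆I) = Equivalence.to T-∧ t in indep edge (toWitness e⊆I))
               (allSubsets n))
  where
  edgeInside : Subset n → Bool
  edgeInside e = isEdge H e ∧ ⌊ e ⊆? I ⌋

independent? : (H : Hypergraph r n) → Decidable (Independent H)
independent? H I = map′ (Equivalence.to (independentᵇ⇔Independent H I))
                        (Equivalence.from (independentᵇ⇔Independent H I)) (T? (independentᵇ H I))

Independent-antimono : (H : Hypergraph r n) {I J : Subset n} → I ⊆ J → Independent H J → Independent H I
Independent-antimono H I⊆J indep edge e⊆I = indep edge (I⊆J ∘ e⊆I)

induced : Hypergraph r n → Subset n → Hypergraph r n
isEdge  (induced G S) e      = isEdge G e ∧ ⌊ e ⊆? S ⌋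
uniform (induced G S) e edge = uniform G e (proj₁ (Equivalence.to T-∧ edge))

link : Hypergraph r n → Fin n → Hypergraph (r ∸ 1) n
isEdge  (link H v) e      = not ⌊ v ∈? e ⌋ ∧ isEdge H (e ∪ ⁅ v ⁆)
uniform (link H v) e edge =
  cong (_∸ 1) (trans (sym (∣p∪⁅x⁆∣≡1+∣p∣ (toWitnessFalse v∉e))) (uniform H (e ∪ ⁅ v ⁆) edge∪v))
  where
  v∉e : T (not ⌊ v ∈? e ⌋)
  v∉e = proj₁ (Equivalence.to (T-∧ {not ⌊ v ∈? e ⌋}) edge)
  edge∪v : T (isEdge H (e ∪ ⁅ v ⁆))
  edge∪v = proj₂ (Equivalence.to (T-∧ {not ⌊ v ∈? e ⌋}) edge)

induced-edge⇔ : (G : Hypergraph r n) (S : Subset n) {e : Subset n} →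
                T (isEdge (induced G S) e) ⇔ (T (isEdge G e) × e ⊆ S)
induced-edge⇔ G S = mk⇔ (Product.map₂ toWitness ∘ Equivalence.to T-∧) (Equivalence.from T-∧ ∘ Product.map₂ fromWitness)

link-edge⇔ : (H : Hypergraph r n) (v : Fin n) {e : Subset n} →
             T (isEdge (link H v) e) ⇔ (v ∉ e × T (isEdge H (e ∪ ⁅ v ⁆)))
link-edge⇔ H v = mk⇔ (Product.map₁ toWitnessFalse ∘ Equivalence.to T-∧) (Equivalence.from T-∧ ∘ Product.map₁ fromWitnessFalse)

Independent-induced : (G : Hypergraph r n) (S : Subset n) {I : Subset n} → Independent G I → Independent (induced G S) I
Independent-induced G S indep edge = indep (proj₁ (Equivalence.to T-∧ edge))

Independent-link : (H : Hypergraph r n) (v : Fin n) {I : Subset n} → Independent H (I ∪ ⁅ v ⁆) → Independent (link H v) I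
Independent-link H v indep edge e⊆I = indep (proj₂ (Equivalence.to T-∧ edge)) (p⊆q⇒p∪r⊆q∪r ⁅ v ⁆ e⊆I)

¬Independent-0-uniform : (H : Hypergraph 0 n) {e I : Subset n} → T (isEdge H e) → ¬ Independent H I
¬Independent-0-uniform H {e} edge indep = indep edge (∣p∣≡0⇒p⊆q (uniform H e edge))

edgeCount : Hypergraph r n → ℕ
edgeCount H = count (T? ∘ isEdge H)

degree : Hypergraph r n → Fin n → ℕ
degree H v = count (λ e → T? (isEdge H e) ×-dec v ∈? e)

EdgesWithin : Hypergraph r n → Subset n → Set
EdgesWithin H X = ∀ {e} → T (isEdge H e) → e ⊆ X

link-within : (H : Hypergraph r n) (v : Fin n) {X : Subset n} → EdgesWithin H X → EdgesWithin (link H v) X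
link-within H v within edge = p∪⁅x⁆⊆q⇒p⊆q (within (proj₂ (Equivalence.to (link-edge⇔ H v) edge)))

edgeCount-link : (H : Hypergraph r n) (v : Fin n) → edgeCount (link H v) ≡ degree H v
edgeCount-link H v = begin
  edgeCount (link H v)
    ≡⟨ count-cong (T? ∘ isEdge (link H v)) (λ e → ¬? (v ∈? e) ×-dec T? (isEdge H (e ∪ ⁅ v ⁆))) (link-edge⇔ H v) ⟩
  count (λ e → ¬? (v ∈? e) ×-dec T? (isEdge H (e ∪ ⁅ v ⁆)))
    ≡⟨ sym (count-∈ v (T? ∘ isEdge H)) ⟩
  count (λ e → v ∈? e ×-dec T? (isEdge H e))
    ≡⟨ count-cong (λ e → v ∈? e ×-dec T? (isEdge H e)) (λ e → T? (isEdge H e) ×-dec v ∈? e) (mk⇔ Product.swap Product.swap) ⟩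
  degree H v ∎
  where open ≡-Reasoning

degreeIn≡degree∘induced : (G : Hypergraph r n) (S : Subset n) (v : Fin n) → degreeIn G S v ≡ degree (induced G S) v
degreeIn≡degree∘induced G S v =
  trans (length-filter-allSubsets (λ e → T? (isEdge G e ∧ (⌊ e ⊆? S ⌋ ∧ ⌊ v ∈? e ⌋)))) (∑ˢ-cong reassociate)
  where
  reassociate : ∀ e → 𝟙 (T? (isEdge G e ∧ (⌊ e ⊆? S ⌋ ∧ ⌊ v ∈? e ⌋))) ≡ 𝟙 (T? (isEdge (induced G S) e) ×-dec v ∈? e)
  reassociate e = cong (λ b → if b then 1 else 0)
    (trans (sym (∧-assoc (isEdge G e) ⌊ e ⊆? S ⌋ ⌊ v ∈? e ⌋))
           (cong (isEdge (induced G S) e ∧_) (isYes≗does (v ∈? e))))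

∑-degree≡r*edgeCount : (H : Hypergraph r n) → sum (degree H) ≡ r * edgeCount H
∑-degree≡r*edgeCount {r} {n} H = begin
  sum (degree H)                                          ≡⟨ sym (∑ˢ-∑-comm (λ v e → 𝟙 (T? (isEdge H e) ×-dec v ∈? e))) ⟩
  ∑ˢ (λ e → sum (λ v → 𝟙 (T? (isEdge H e) ×-dec v ∈? e))) ≡⟨ ∑ˢ-cong ∑-incidences ⟩
  ∑ˢ (λ e → r * 𝟙 (T? (isEdge H e)))                      ≡⟨ ∑ˢ-distribˡ-* r (λ e → 𝟙 (T? (isEdge H e))) ⟩
  r * edgeCount H                                          ∎
  where
  open ≡-Reasoning
  ∑-incidences : ∀ e → sum (λ v → 𝟙 (T? (isEdge H e) ×-dec v ∈? e)) ≡ r * 𝟙 (T? (isEdge H e))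
  ∑-incidences e with isEdge H e | uniform H e
  ... | true  | ∣e∣≡r = trans (sym (∣p∣≡∑[x∈p] e)) (trans (∣e∣≡r _) (sym (*-identityʳ r)))
  ... | false | _     = trans (sum-replicate-zero n) (sym (*-zeroʳ r))

edgeCount≤∣X∣Cr : (H : Hypergraph r n) {X : Subset n} → EdgesWithin H X → edgeCount H ≤ ∣ X ∣ C r
edgeCount≤∣X∣Cr {r} H {X} within = begin
  edgeCount H                                ≤⟨ count-mono (T? ∘ isEdge H) (λ e → e ⊆? X ×-dec ∣ e ∣ ≟ r)
                                                  (λ edge → within edge , uniform H _ edge) ⟩
  count (λ e → e ⊆? X ×-dec ∣ e ∣ ≟ r)      ≡⟨ count-subsets-of-size X r ⟩
  ∣ X ∣ C r                                  ∎
  where open ≤-Reasoning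

degree≤∣X∣C[r∸1] : (H : Hypergraph r n) (v : Fin n) {X : Subset n} → EdgesWithin H X → degree H v ≤ ∣ X ∣ C (r ∸ 1)
degree≤∣X∣C[r∸1] H v within = subst (_≤ _) (edgeCount-link H v) (edgeCount≤∣X∣Cr (link H v) (link-within H v within))

degree-outside : (H : Hypergraph r n) {X : Subset n} {w : Fin n} → EdgesWithin H X → w ∉ X → degree H w ≡ 0
degree-outside H {w = w} within w∉X =
  count-empty (λ e → T? (isEdge H e) ×-dec w ∈? e) (λ e (edge , w∈e) → w∉X (within edge w∈e))

foldr-⊔-attained : ∀ {b} {B : Set b} (f : B → ℕ) (xs : List B) →
               0 < List.foldr _⊔_ 0 (map f xs) → ∃ λ x → List.foldr _⊔_ 0 (map f xs) ≡ f x
foldr-⊔-attained f (x List.∷ xs) 0<max with ⊔-sel (f x) (List.foldr _⊔_ 0 (map f xs))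
... | inj₁ max≡fx   = x , max≡fx
... | inj₂ max≡rest = Product.map₂ (trans max≡rest) (foldr-⊔-attained f xs (subst (0 <_) max≡rest 0<max))

maxDegreeIn-attained : (G : Hypergraph r n) (S : Subset n) → 0 < maxDegreeIn G S →
                       ∃ λ v → v ∈ S × maxDegreeIn G S ≡ degree (induced G S) v
maxDegreeIn-attained {n = n} G S 0<max with foldr-⊔-attained (degreeIn G S) (allFin n) 0<max
... | v , max≡degreeIn = v , v∈S , max≡degree
  where
  max≡degree : maxDegreeIn G S ≡ degree (induced G S) v
  max≡degree = trans max≡degreeIn (degreeIn≡degree∘induced G S v)
  v∈S : v ∈ S
  v∈S = let (e , edge , v∈e) = count-witness (λ e → T? (isEdge (induced G S) e) ×-dec v ∈? e)
                                             (subst (0 <_) max≡degree 0<max)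
        in proj₂ (Equivalence.to (induced-edge⇔ G S) edge) v∈e

link-induced-within : (G : Hypergraph r n) (S : Subset n) (v : Fin n) → EdgesWithin (link (induced G S) v) (S ─ ⁅ v ⁆)
link-induced-within G S v edge =
  let (v∉e , edge∪v) = Equivalence.to (link-edge⇔ (induced G S) v) edge
  in p⊆q∧x∉p⇒p⊆q─⁅x⁆ (p∪⁅x⁆⊆q⇒p⊆q (proj₂ (Equivalence.to (induced-edge⇔ G S) edge∪v))) v∉e

subsetCount : {P : Pred (Subset n) a} → Decidable P → Subset n → ℕ → ℕ
subsetCount P? R k = count (λ I → I ⊆? R ×-dec ∣ I ∣ ≟ k ×-dec P? I)

subsetCount-split : {P : Pred (Subset n) a} {Q : Pred (Subset n) b} (P? : Decidable P) (Q? : Decidable Q) (v : Fin n) →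
                    (∀ {I} → P (I ∪ ⁅ v ⁆) → Q I) → ∀ R k →
                    subsetCount P? R k ≤ subsetCount P? (R ─ ⁅ v ⁆) k + subsetCount Q? (R ─ ⁅ v ⁆) (k ∸ 1)
subsetCount-split {P = P} {Q} P? Q? v P⇒Q R k = begin
  subsetCount P? R k                                     ≡⟨ count-split A? (v ∈?_) ⟩
  count without-v + count (λ I → A? I ×-dec v ∈? I)    ≡⟨ cong (count without-v +_) with-v≡ ⟩
  count without-v + count with-v                       ≤⟨ +-mono-≤ avoiding containing ⟩
  subsetCount P? (R ─ ⁅ v ⁆) k + subsetCount Q? (R ─ ⁅ v ⁆) (k ∸ 1) ∎
  where
  open ≤-Reasoning
  A? = λ I → I ⊆? R ×-dec ∣ I ∣ ≟ k ×-dec P? I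
  without-v = λ I → A? I ×-dec ¬? (v ∈? I)
  with-v    = λ I → ¬? (v ∈? I) ×-dec A? (I ∪ ⁅ v ⁆)
  with-v≡ : count (λ I → A? I ×-dec v ∈? I) ≡ count with-v
  with-v≡ = trans (count-cong (λ I → A? I ×-dec v ∈? I) (λ I → v ∈? I ×-dec A? I) (mk⇔ Product.swap Product.swap))
                  (count-∈ v A?)
  avoiding : count without-v ≤ subsetCount P? (R ─ ⁅ v ⁆) k
  avoiding = count-mono without-v (λ I → I ⊆? R ─ ⁅ v ⁆ ×-dec ∣ I ∣ ≟ k ×-dec P? I)
    (λ ((I⊆R , ∣I∣≡k , pI) , v∉I) → p⊆q∧x∉p⇒p⊆q─⁅x⁆ I⊆R v∉I , ∣I∣≡k , pI)
  containing : count with-v ≤ subsetCount Q? (R ─ ⁅ v ⁆) (k ∸ 1)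
  containing = count-mono with-v (λ I → I ⊆? R ─ ⁅ v ⁆ ×-dec ∣ I ∣ ≟ k ∸ 1 ×-dec Q? I)
    (λ (v∉I , I∪v⊆R , ∣I∪v∣≡k , pI∪v) →
       p⊆q∧x∉p⇒p⊆q─⁅x⁆ (p∪⁅x⁆⊆q⇒p⊆q I∪v⊆R) v∉I ,
       cong (_∸ 1) (trans (sym (∣p∪⁅x⁆∣≡1+∣p∣ v∉I)) ∣I∪v∣≡k) ,
       P⇒Q pI∪v)

numIndependent≡subsetCount : ∀ {r n} (G : Hypergraph r n) (k : ℕ) → numIndependent G k ≡ subsetCount (independent? G) ⊤ k
numIndependent≡subsetCount G k =
  trans (length-filter-allSubsets (λ I → T? (independentᵇ G I ∧ ⌊ ∣ I ∣ ≟ k ⌋)))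
        (count-cong (λ I → T? (independentᵇ G I ∧ ⌊ ∣ I ∣ ≟ k ⌋)) (λ I → I ⊆? ⊤ ×-dec ∣ I ∣ ≟ k ×-dec independent? G I)
          (λ {I} → mk⇔
            (λ t → let (indep , ∣I∣≡k) = Equivalence.to (T-∧ {independentᵇ G I}) t
                   in (λ {_} → ⊆⊤) , toWitness ∣I∣≡k , (λ {_} → Equivalence.to (independentᵇ⇔Independent G I) indep))
            (λ (_ , ∣I∣≡k , indep) →
               Equivalence.from (T-∧ {independentᵇ G I})
                 (Equivalence.from (independentᵇ⇔Independent G I) indep , fromWitness ∣I∣≡k))))

-- With ε = p / q: if a + d ≤ m and d ≥ ε m, then a ≤ (1 - ε) m.
shrink-step : ∀ {p q u m a d} ℓ → .{{NonZero q}} → a + d ≤ m → p * m ≤ q * d →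
              (q ∸ p) ^ suc ℓ * m ≤ q ^ suc ℓ * u → (q ∸ p) ^ ℓ * a ≤ q ^ ℓ * u
shrink-step {p} {q} {u} {m} {a} {d} ℓ a+d≤m pm≤qd shrunk = *-cancelˡ-≤ q (begin
  q * ((q ∸ p) ^ ℓ * a)       ≡⟨ x*[y*z]≡y*[x*z] q ((q ∸ p) ^ ℓ) a ⟩
  (q ∸ p) ^ ℓ * (q * a)       ≤⟨ *-monoʳ-≤ ((q ∸ p) ^ ℓ) qa≤[q∸p]m ⟩
  (q ∸ p) ^ ℓ * ((q ∸ p) * m) ≡⟨ x*[y*z]≡y*[x*z] ((q ∸ p) ^ ℓ) (q ∸ p) m ⟩
  (q ∸ p) * ((q ∸ p) ^ ℓ * m) ≡⟨ sym (*-assoc (q ∸ p) _ m) ⟩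
  (q ∸ p) ^ suc ℓ * m          ≤⟨ shrunk ⟩
  q ^ suc ℓ * u                ≡⟨ *-assoc q (q ^ ℓ) u ⟩
  q * (q ^ ℓ * u)              ∎)
  where
  open ≤-Reasoning
  qa≤[q∸p]m : q * a ≤ (q ∸ p) * m
  qa≤[q∸p]m = begin
    q * a               ≤⟨ m+n≤o⇒m≤o∸n (q * a) (begin
      q * a + p * m       ≤⟨ +-monoʳ-≤ (q * a) pm≤qd ⟩
      q * a + q * d       ≡⟨ sym (*-distribˡ-+ q a d) ⟩
      q * (a + d)         ≤⟨ *-monoʳ-≤ q a+d≤m ⟩
      q * m               ∎) ⟩
    q * m ∸ p * m       ≡⟨ sym (*-distribʳ-∸ m q p) ⟩
    (q ∸ p) * m         ∎

double-count-arith : ∀ {p q m c d} M j → (m ≡ 0 ⊎ 0 < M) → p * (m * M) ≤ q * c →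
                     q * (suc (suc j) * c) ≤ M * (q * d) + M * (p * m) → p * m ≤ q * d
double-count-arith {p} {q} {m} {c} {d} M j (inj₁ refl) _ _ = subst (_≤ q * d) (sym (*-zeroʳ p)) z≤n
double-count-arith {p} {q} {m} {c} {d} M j (inj₂ 0<M) dense handshake =
  *-cancelˡ-≤ M {{>-nonZero 0<M}} (+-cancelʳ-≤ (M * (p * m)) (M * (p * m)) (M * (q * d)) (begin
    M * (p * m) + M * (p * m)   ≡⟨ solve 3 (λ M p m → M :* (p :* m) :+ M :* (p :* m) := con 2 :* (p :* (m :* M))) refl M p m ⟩
    2 * (p * (m * M))           ≤⟨ *-monoʳ-≤ 2 dense ⟩
    2 * (q * c)                 ≡⟨ solve 2 (λ q c → con 2 :* (q :* c) := q :* (con 2 :* c)) refl q c ⟩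
    q * (2 * c)                 ≤⟨ *-monoʳ-≤ q (*-monoˡ-≤ c {2} {suc (suc j)} (s≤s (s≤s z≤n))) ⟩
    q * (suc (suc j) * c)       ≤⟨ handshake ⟩
    M * (q * d) + M * (p * m)   ∎))
  where
  open ≤-Reasoning
  open +-*-Solver

[a∸1]+a*ℓ≤t : ∀ {a ℓ t} → 1 ≤ a → a * suc ℓ ≤ suc t → (a ∸ 1) + a * ℓ ≤ t
[a∸1]+a*ℓ≤t {suc a} {ℓ} {t} _ a*[1+ℓ]≤1+t = ≤-pred (subst (_≤ suc t) (*-suc (suc a) ℓ) a*[1+ℓ]≤1+t)

module HeavyVertices (p q : ℕ) (p≤q : p ≤ q) {X : Subset n} {m : ℕ} (∣X∣≤m : ∣ X ∣ ≤ m) where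

  Heavy : Hypergraph (suc j) n → Fin n → Set
  Heavy {j} H w = w ∈ X × p * m ^ j ≤ q * degree H w

  heavy? : (H : Hypergraph (suc j) n) → Decidable (Heavy H)
  heavy? {j} H w = w ∈? X ×-dec p * m ^ j ≤? q * degree H w

  #heavy : Hypergraph (suc j) n → ℕ
  #heavy H = sum (λ w → 𝟙 (heavy? H w))

  degree≤m^j : (H : Hypergraph (suc j) n) (w : Fin n) → EdgesWithin H X → degree H w ≤ m ^ j
  degree≤m^j {j} H w within = begin
    degree H w  ≤⟨ degree≤∣X∣C[r∸1] H w within ⟩
    ∣ X ∣ C j   ≤⟨ nCk≤n^k ∣ X ∣ j ⟩
    ∣ X ∣ ^ j   ≤⟨ ^-monoˡ-≤ j ∣X∣≤m ⟩
    m ^ j       ∎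
    where open ≤-Reasoning

  q*degree≤ : (H : Hypergraph (suc j) n) (w : Fin n) → EdgesWithin H X →
              q * degree H w ≤ m ^ j * (q * 𝟙 (heavy? H w)) + m ^ j * (p * 𝟙 (w ∈? X))
  q*degree≤ {j} H w within with heavy? H w
  ... | yes heavy = begin
    q * degree H w                  ≤⟨ *-monoʳ-≤ q (degree≤m^j H w within) ⟩
    q * m ^ j                       ≡⟨ *-comm q (m ^ j) ⟩
    m ^ j * q                       ≡⟨ cong (m ^ j *_) (*-identityʳ q) ⟨
    m ^ j * (q * 1)                 ≡⟨ cong (λ z → m ^ j * (q * z)) (𝟙-yes (heavy? H w) heavy) ⟨
    m ^ j * (q * 𝟙 (heavy? H w))    ≤⟨ m≤m+n _ _ ⟩
    m ^ j * (q * 𝟙 (heavy? H w)) + m ^ j * (p * 𝟙 (w ∈? X)) ∎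
    where open ≤-Reasoning
  ... | no light with w ∈? X
  ...   | no w∉X = ≤-trans (≤-reflexive (trans (cong (q *_) (degree-outside H within w∉X)) (*-zeroʳ q))) z≤n
  ...   | yes w∈X = ≤-trans (<⇒≤ (≰⇒> (light ∘ (w∈X ,_))))
                            (≤-trans (≤-reflexive (trans (*-comm p (m ^ j)) (cong (m ^ j *_) (sym (*-identityʳ p)))))
                                     (m≤n+m _ _))

  q*degree≤-1-uniform : (H : Hypergraph 1 n) (w : Fin n) → EdgesWithin H X → q * degree H w ≤ q * 𝟙 (heavy? H w)
  q*degree≤-1-uniform H w within with heavy? H w
  ... | yes heavy = ≤-trans (*-monoʳ-≤ q (degree≤m^j H w within)) (≤-reflexive (cong (q *_) (sym (𝟙-yes (heavy? H w) heavy))))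
  ... | no light = ≤-trans (*-monoʳ-≤ q degree≤0) (≤-reflexive (cong (q *_) (sym (𝟙-no (heavy? H w) light))))
    where
    degree≤0 : degree H w ≤ 0
    degree≤0 with w ∈? X
    ... | no w∉X  = ≤-reflexive (degree-outside H within w∉X)
    ... | yes w∈X = <⇒≤pred (*-cancelˡ-< q _ _ (≤-trans (≰⇒> (light ∘ (w∈X ,_))) (*-monoˡ-≤ 1 p≤q)))

  -- Summing q · degree over all vertices: (j + 1) |H| ≤ m^j #heavy + ε m^j |X|, which together with
  -- |H| ≥ ε m^(j + 1) gives #heavy ≥ ε m as soon as j ≥ 1. For j = 0 a vertex that is not heavy has
  -- degree below ε ≤ 1, that is 0, so |H| ≤ #heavy directly.
  p*m≤q*#heavy : (H : Hypergraph (suc j) n) → EdgesWithin H X → p * m ^ suc j ≤ q * edgeCount H → p * m ≤ q * #heavy H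
  p*m≤q*#heavy {zero} H within dense = begin
    p * m                           ≡⟨ cong (p *_) (*-identityʳ m) ⟨
    p * m ^ 1                       ≤⟨ dense ⟩
    q * edgeCount H                 ≡⟨ cong (q *_) (trans (∑-degree≡r*edgeCount H) (+-identityʳ _)) ⟨
    q * sum (degree H)              ≡⟨ *-distribˡ-sum q (degree H) ⟩
    sum (λ w → q * degree H w)      ≤⟨ ∑-mono-≤ (λ w → q*degree≤-1-uniform H w within) ⟩
    sum (λ w → q * 𝟙 (heavy? H w))  ≡⟨ *-distribˡ-sum q (λ w → 𝟙 (heavy? H w)) ⟨
    q * #heavy H                    ∎
    where open ≤-Reasoning
  p*m≤q*#heavy {suc j} H within dense = double-count-arith {p} {q} M j (m≡0⊎0<M m) dense (begin
    q * (suc (suc j) * edgeCount H)   ≡⟨ cong (q *_) (∑-degree≡r*edgeCount H) ⟨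
    q * sum (degree H)                ≡⟨ *-distribˡ-sum q (degree H) ⟩
    sum (λ w → q * degree H w)        ≤⟨ ∑-mono-≤ (λ w → q*degree≤ H w within) ⟩
    sum (λ w → M * (q * 𝟙 (heavy? H w)) + M * (p * 𝟙 (w ∈? X)))
      ≡⟨ ∑-distrib-+ (λ w → M * (q * 𝟙 (heavy? H w))) (λ w → M * (p * 𝟙 (w ∈? X))) ⟩
    sum (λ w → M * (q * 𝟙 (heavy? H w))) + sum (λ w → M * (p * 𝟙 (w ∈? X)))
      ≡⟨ cong₂ _+_ (M*[c*∑]≡∑[M*[c*_]] q (λ w → 𝟙 (heavy? H w)))
                   (trans (cong (λ s → M * (p * s)) (∣p∣≡∑[x∈p] X)) (M*[c*∑]≡∑[M*[c*_]] p (λ w → 𝟙 (w ∈? X)))) ⟨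
    M * (q * #heavy H) + M * (p * ∣ X ∣)   ≤⟨ +-monoʳ-≤ (M * (q * #heavy H)) (*-monoʳ-≤ M (*-monoʳ-≤ p ∣X∣≤m)) ⟩
    M * (q * #heavy H) + M * (p * m)       ∎)
    where
    open ≤-Reasoning
    M = m ^ suc j
    m≡0⊎0<M : ∀ m → m ≡ 0 ⊎ 0 < m ^ suc j
    m≡0⊎0<M zero    = inj₁ refl
    m≡0⊎0<M (suc m) = inj₂ (m^n>0 (suc m) (suc j))
    M*[c*∑]≡∑[M*[c*_]] : ∀ c (f : Fin n → ℕ) → M * (c * sum f) ≡ sum (λ w → M * (c * f w))
    M*[c*∑]≡∑[M*[c*_]] c f = trans (cong (M *_) (*-distribˡ-sum c f)) (*-distribˡ-sum M (λ w → c * f w))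

  ∣R∣+#heavy≤m : (H : Hypergraph (suc j) n) {R : Subset n} → R ⊆ X → (∀ {w} → w ∈ R → ¬ Heavy H w) →
                ∣ R ∣ + #heavy H ≤ m
  ∣R∣+#heavy≤m H {R} R⊆X R-light = begin
    ∣ R ∣ + #heavy H                                    ≡⟨ cong (_+ #heavy H) (∣p∣≡∑[x∈p] R) ⟩
    sum (λ w → 𝟙 (w ∈? R)) + #heavy H                 ≡⟨ ∑-distrib-+ (λ w → 𝟙 (w ∈? R)) (λ w → 𝟙 (heavy? H w)) ⟨
    sum (λ w → 𝟙 (w ∈? R) + 𝟙 (heavy? H w))           ≤⟨ ∑-mono-≤ disjoint ⟩
    sum (λ w → 𝟙 (w ∈? X))                             ≡⟨ ∣p∣≡∑[x∈p] X ⟨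
    ∣ X ∣                                               ≤⟨ ∣X∣≤m ⟩
    m                                                   ∎
    where
    open ≤-Reasoning
    disjoint : ∀ w → 𝟙 (w ∈? R) + 𝟙 (heavy? H w) ≤ 𝟙 (w ∈? X)
    disjoint w = 𝟙-disjoint (w ∈? R) (heavy? H w) (w ∈? X) R⊆X proj₁ R-light

ℕtoℚ≡mkℚ : ∀ a → ℕtoℚ a ≡ mkℚ (ℤ.+ a) 0 (coprime-sym (1-coprimeTo a))
ℕtoℚ≡mkℚ a = normalize-coprime (coprime-sym (1-coprimeTo a))

ℕtoℚ-nonNeg : ∀ a → NonNegative (ℕtoℚ a)
ℕtoℚ-nonNeg a rewrite ℕtoℚ≡mkℚ a = _

ℕtoℚ-cancel-≤ : ∀ {a b} → ℕtoℚ a ≤ℚ ℕtoℚ b → a ≤ b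
ℕtoℚ-cancel-≤ {a} {b} a≤b rewrite ℕtoℚ≡mkℚ a | ℕtoℚ≡mkℚ b with a≤b
... | *≤* a*1≤b*1 rewrite ℤₚ.*-identityʳ (ℤ.+ a) | ℤₚ.*-identityʳ (ℤ.+ b) with a*1≤b*1
... | ℤ.+≤+ a≤b′ = a≤b′

ℕtoℚ-+ : ∀ a b → ℕtoℚ (a + b) ≡ ℕtoℚ a +ℚ ℕtoℚ b
ℕtoℚ-+ a b = toℚᵘ-injective (ℚᵘₚ.≃-trans unnormalised (ℚᵘₚ.≃-sym (toℚᵘ-homo-+ (ℕtoℚ a) (ℕtoℚ b))))
  where
  unnormalised : toℚᵘ (ℕtoℚ (a + b)) ℚᵘ.≃ toℚᵘ (ℕtoℚ a) ℚᵘ.+ toℚᵘ (ℕtoℚ b)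
  unnormalised rewrite ℕtoℚ≡mkℚ (a + b) | ℕtoℚ≡mkℚ a | ℕtoℚ≡mkℚ b | ℤₚ.*-identityʳ (ℤ.+ a) | ℤₚ.*-identityʳ (ℤ.+ b) =
    ℚᵘ.*≡* (cong (ℤ._* ℤ.+ 1) (ℤₚ.pos-+ a b))

ℕtoℚ-* : ∀ a b → ℕtoℚ (a * b) ≡ ℕtoℚ a *ℚ ℕtoℚ b
ℕtoℚ-* a b = toℚᵘ-injective (ℚᵘₚ.≃-trans unnormalised (ℚᵘₚ.≃-sym (toℚᵘ-homo-* (ℕtoℚ a) (ℕtoℚ b))))
  where
  unnormalised : toℚᵘ (ℕtoℚ (a * b)) ℚᵘ.≃ toℚᵘ (ℕtoℚ a) ℚᵘ.* toℚᵘ (ℕtoℚ b)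
  unnormalised rewrite ℕtoℚ≡mkℚ (a * b) | ℕtoℚ≡mkℚ a | ℕtoℚ≡mkℚ b = ℚᵘ.*≡* (cong (ℤ._* ℤ.+ 1) (ℤₚ.pos-* a b))

ℕtoℚ-^ : ∀ a k → ℕtoℚ (a ^ k) ≡ ℕtoℚ a ^ℚ k
ℕtoℚ-^ a zero    = refl
ℕtoℚ-^ a (suc k) = trans (ℕtoℚ-* a (a ^ k)) (cong (ℕtoℚ a *ℚ_) (ℕtoℚ-^ a k))

^ℚ-distribʳ-* : ∀ x y k → (x *ℚ y) ^ℚ k ≡ (x ^ℚ k) *ℚ (y ^ℚ k)
^ℚ-distribʳ-* x y zero    = refl
^ℚ-distribʳ-* x y (suc k) =
  trans (cong ((x *ℚ y) *ℚ_) (^ℚ-distribʳ-* x y k))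
        (solve 4 (λ x y X Y → (x :* y) :* (X :* Y) := (x :* X) :* (y :* Y)) refl x y (x ^ℚ k) (y ^ℚ k))
  where open ℚ-Solver.+-*-Solver

clear-denominator : ∀ {x y a b} c → x *ℚ ℕtoℚ c ≡ ℕtoℚ a → y *ℚ ℕtoℚ c ≡ ℕtoℚ b → x ≤ℚ y → a ≤ b
clear-denominator c xc≡a yc≡b x≤y =
  ℕtoℚ-cancel-≤ (subst₂ _≤ℚ_ xc≡a yc≡b (*-monoʳ-≤-nonNeg (ℕtoℚ c) {{ℕtoℚ-nonNeg c}} x≤y))

as-fraction : ∀ ε → 0ℚ <ℚ ε → ε ≤ℚ 1ℚ → ∃ λ p → ∃ λ q → 1 ≤ p × p ≤ q × ε *ℚ ℕtoℚ q ≡ ℕtoℚ p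
as-fraction (mkℚ (ℤ.+ zero) _ _) (*<* (ℤ.+<+ ()))
as-fraction (mkℚ ℤ.-[1+ _ ] _ _) (*<* ())
as-fraction ε@(mkℚ (ℤ.+ suc p) d _) _ (*≤* p*1≤1*q) = suc p , suc d , s≤s z≤n , p≤q , toℚᵘ-injective ε*q≃p
  where
  p≤q : suc p ≤ suc d
  p≤q with subst₂ ℤ._≤_ (ℤₚ.*-identityʳ (ℤ.+ suc p)) (ℤₚ.*-identityˡ (ℤ.+ suc d)) p*1≤1*q
  ... | ℤ.+≤+ p≤q′ = p≤q′
  ε*q≃p : toℚᵘ (ε *ℚ ℕtoℚ (suc d)) ℚᵘ.≃ toℚᵘ (ℕtoℚ (suc p))
  ε*q≃p = ℚᵘₚ.≃-trans (toℚᵘ-homo-* ε (ℕtoℚ (suc d))) unnormalised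
    where
    unnormalised : toℚᵘ ε ℚᵘ.* toℚᵘ (ℕtoℚ (suc d)) ℚᵘ.≃ toℚᵘ (ℕtoℚ (suc p))
    unnormalised rewrite ℕtoℚ≡mkℚ (suc d) | ℕtoℚ≡mkℚ (suc p) =
      ℚᵘ.*≡* (trans (ℤₚ.*-identityʳ _) (cong (λ z → ℤ.+ suc p ℤ.* ℤ.+ z) (sym (*-identityʳ (suc d)))))

module _ {ε : ℚ} {p q : ℕ} (p≤q : p ≤ q) (ε*q≡p : ε *ℚ ℕtoℚ q ≡ ℕtoℚ p) where

  open ℚ-Solver.+-*-Solver

  ε*x≤y⇒p*x≤q*y : ∀ {x y} → ε *ℚ ℕtoℚ x ≤ℚ ℕtoℚ y → p * x ≤ q * y
  ε*x≤y⇒p*x≤q*y {x} {y} εx≤y = subst (p * x ≤_) (*-comm y q) (clear-denominator q εxq≡px (sym (ℕtoℚ-* y q)) εx≤y)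
    where
    εxq≡px : ε *ℚ ℕtoℚ x *ℚ ℕtoℚ q ≡ ℕtoℚ (p * x)
    εxq≡px = begin
      ε *ℚ ℕtoℚ x *ℚ ℕtoℚ q    ≡⟨ solve 3 (λ e x q → e :* x :* q := (e :* q) :* x) refl ε (ℕtoℚ x) (ℕtoℚ q) ⟩
      ε *ℚ ℕtoℚ q *ℚ ℕtoℚ x    ≡⟨ cong (_*ℚ ℕtoℚ x) ε*q≡p ⟩
      ℕtoℚ p *ℚ ℕtoℚ x         ≡⟨ sym (ℕtoℚ-* p x) ⟩
      ℕtoℚ (p * x)             ∎
      where open ≡-Reasoning

  [1-ε]*q≡q∸p : (1ℚ - ε) *ℚ ℕtoℚ q ≡ ℕtoℚ (q ∸ p)
  [1-ε]*q≡q∸p = begin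
    (1ℚ - ε) *ℚ ℕtoℚ q                  ≡⟨ solve 2 (λ e q → (con 1ℚ :- e) :* q := q :- e :* q) refl ε (ℕtoℚ q) ⟩
    ℕtoℚ q - ε *ℚ ℕtoℚ q                ≡⟨ cong (ℕtoℚ q -_) ε*q≡p ⟩
    ℕtoℚ q - ℕtoℚ p                      ≡⟨ cong (_- ℕtoℚ p) (trans (cong ℕtoℚ (sym (m∸n+n≡m p≤q))) (ℕtoℚ-+ (q ∸ p) p)) ⟩
    (ℕtoℚ (q ∸ p) +ℚ ℕtoℚ p) - ℕtoℚ p    ≡⟨ solve 2 (λ x y → (x :+ y) :- y := x) refl (ℕtoℚ (q ∸ p)) (ℕtoℚ p) ⟩
    ℕtoℚ (q ∸ p)                         ∎
    where open ≡-Reasoning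

  [1-ε]^ℓ*x≤y⇒[q∸p]^ℓ*x≤q^ℓ*y : ∀ ℓ {x y} → ((1ℚ - ε) ^ℚ ℓ) *ℚ ℕtoℚ x ≤ℚ ℕtoℚ y → (q ∸ p) ^ ℓ * x ≤ q ^ ℓ * y
  [1-ε]^ℓ*x≤y⇒[q∸p]^ℓ*x≤q^ℓ*y ℓ {x} {y} shrunk =
    subst ((q ∸ p) ^ ℓ * x ≤_) (*-comm y (q ^ ℓ)) (clear-denominator (q ^ ℓ) scaled (sym (ℕtoℚ-* y (q ^ ℓ))) shrunk)
    where
    scaled : ((1ℚ - ε) ^ℚ ℓ) *ℚ ℕtoℚ x *ℚ ℕtoℚ (q ^ ℓ) ≡ ℕtoℚ ((q ∸ p) ^ ℓ * x)
    scaled = begin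
      ((1ℚ - ε) ^ℚ ℓ) *ℚ ℕtoℚ x *ℚ ℕtoℚ (q ^ ℓ)      ≡⟨ cong (((1ℚ - ε) ^ℚ ℓ) *ℚ ℕtoℚ x *ℚ_) (ℕtoℚ-^ q ℓ) ⟩
      ((1ℚ - ε) ^ℚ ℓ) *ℚ ℕtoℚ x *ℚ (ℕtoℚ q ^ℚ ℓ)
        ≡⟨ solve 3 (λ a x b → a :* x :* b := (a :* b) :* x) refl ((1ℚ - ε) ^ℚ ℓ) (ℕtoℚ x) (ℕtoℚ q ^ℚ ℓ) ⟩
      ((1ℚ - ε) ^ℚ ℓ *ℚ ℕtoℚ q ^ℚ ℓ) *ℚ ℕtoℚ x       ≡⟨ cong (_*ℚ ℕtoℚ x) (sym (^ℚ-distribʳ-* (1ℚ - ε) (ℕtoℚ q) ℓ)) ⟩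
      ((1ℚ - ε) *ℚ ℕtoℚ q) ^ℚ ℓ *ℚ ℕtoℚ x            ≡⟨ cong (λ z → z ^ℚ ℓ *ℚ ℕtoℚ x) [1-ε]*q≡q∸p ⟩
      ℕtoℚ (q ∸ p) ^ℚ ℓ *ℚ ℕtoℚ x                     ≡⟨ cong (_*ℚ ℕtoℚ x) (sym (ℕtoℚ-^ (q ∸ p) ℓ)) ⟩
      ℕtoℚ ((q ∸ p) ^ ℓ) *ℚ ℕtoℚ x                    ≡⟨ sym (ℕtoℚ-* ((q ∸ p) ^ ℓ) x) ⟩
      ℕtoℚ ((q ∸ p) ^ ℓ * x)                          ∎
      where open ≡-Reasoning

module IndependentSets {r n : ℕ} (G : Hypergraph r n) (u p q : ℕ) (1≤p : 1 ≤ p) (p≤q : p ≤ q) where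

  instance
    q≢0 : NonZero q
    q≢0 = >-nonZero (≤-trans 1≤p p≤q)

  p*y≤q*x⇒0<x : ∀ {x y} → 0 < y → p * y ≤ q * x → 0 < x
  p*y≤q*x⇒0<x {zero}  0<y py≤q*0 = contradiction (≤-trans (*-mono-≤ 1≤p 0<y) (≤-trans py≤q*0 (≤-reflexive (*-zeroʳ q)))) λ ()
  p*y≤q*x⇒0<x {suc x} _   _      = s≤s z≤n

  #indep : Subset n → ℕ → ℕ
  #indep = subsetCount (independent? G)

  #indep-with : Hypergraph j n → Subset n → ℕ → ℕ
  #indep-with H = subsetCount (λ I → independent? G I ×-dec independent? H I)

  -- ε = p / q: Shrunk ℓ s reads (1 - ε)^ℓ s ≤ u, and p * m ^ j ≤ q * edgeCount H says that H has at least
  -- ε m^j edges.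

  Bound : ℕ → Subset n → Set
  Bound ℓ S = ∀ {k t} → (r ∸ 1) * ℓ ≤ t → t ≤ k → #indep S k ≤ (∣ S ∣ C t) * (u C (k ∸ t))

  Shrunk : ℕ → ℕ → Set
  Shrunk ℓ s = (q ∸ p) ^ ℓ * s ≤ q ^ ℓ * u

  #indep-with-0-uniform : (H : Hypergraph 0 n) → p * 1 ≤ q * edgeCount H → ∀ R k → #indep-with H R k ≡ 0
  #indep-with-0-uniform H dense R k =
    count-empty (λ I → I ⊆? R ×-dec ∣ I ∣ ≟ k ×-dec independent? G I ×-dec independent? H I)
                (λ I (_ , _ , _ , indep) → ¬Independent-0-uniform H edge indep)
    where
    edge = proj₂ (count-witness (T? ∘ isEdge H) (p*y≤q*x⇒0<x (s≤s z≤n) dense))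

  small-bound : ∀ {S k t} → ∣ S ∣ ≤ u → t ≤ k → #indep S k ≤ (∣ S ∣ C t) * (u C (k ∸ t))
  small-bound {S} {k} {t} ∣S∣≤u t≤k = begin
    #indep S k                             ≤⟨ count-mono (λ I → I ⊆? S ×-dec ∣ I ∣ ≟ k ×-dec independent? G I)
                                                         (λ I → I ⊆? S ×-dec ∣ I ∣ ≟ k) (Product.map₂ proj₁) ⟩
    count (λ I → I ⊆? S ×-dec ∣ I ∣ ≟ k)   ≡⟨ count-subsets-of-size S k ⟩
    ∣ S ∣ C k                              ≤⟨ sCk≤sCt*uC[k∸t] t k ∣S∣≤u t≤k ⟩
    (∣ S ∣ C t) * (u C (k ∸ t))            ∎
    where open ≤-Reasoning

  #indep-with-split : (H : Hypergraph j n) (d : Fin n) (R : Subset n) (k : ℕ) →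
                      #indep-with H R k ≤ #indep-with H (R ─ ⁅ d ⁆) k + #indep-with (link H d) (R ─ ⁅ d ⁆) (k ∸ 1)
  #indep-with-split H d =
    subsetCount-split (λ I → independent? G I ×-dec independent? H I) (λ I → independent? G I ×-dec independent? (link H d) I) d
                      (Product.map (Independent-antimono G (p⊆p∪q _)) (Independent-link H d))

  #indep-split : (S : Subset n) (v : Fin n) (k : ℕ) →
                 #indep S k ≤ #indep (S ─ ⁅ v ⁆) k + #indep-with (link (induced G S) v) (S ─ ⁅ v ⁆) (k ∸ 1)
  #indep-split S v =
    subsetCount-split (independent? G) (λ I → independent? G I ×-dec independent? (link (induced G S) v) I) v
                      (λ indep → Independent-antimono G (p⊆p∪q _) indep ,
                                 Independent-link (induced G S) v (Independent-induced G S indep))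
                      S

  #indep-with≤#indep : (H : Hypergraph j n) (R : Subset n) (k : ℕ) → #indep-with H R k ≤ #indep R k
  #indep-with≤#indep H R k =
    count-mono (λ I → I ⊆? R ×-dec ∣ I ∣ ≟ k ×-dec independent? G I ×-dec independent? H I)
               (λ I → I ⊆? R ×-dec ∣ I ∣ ≟ k ×-dec independent? G I)
               (Product.map₂ (Product.map₂ proj₁))

  module WithDenseHypergraph (ℓ : ℕ) (bound-ℓ : ∀ {S} → Shrunk ℓ ∣ S ∣ → Bound ℓ S)
                             {X : Subset n} {m : ℕ} (∣X∣≤m : ∣ X ∣ ≤ m) (shrunk : Shrunk (suc ℓ) m) where

    open HeavyVertices p q p≤q {X} ∣X∣≤m

    dense-link : (H : Hypergraph (suc j) n) {d : Fin n} → Heavy H d → p * m ^ j ≤ q * edgeCount (link H d)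
    dense-link {j} H {d} heavy = subst (λ c → p * m ^ j ≤ q * c) (sym (edgeCount-link H d)) (proj₂ heavy)

    bound-with : (H : Hypergraph j n) → EdgesWithin H X → p * m ^ j ≤ q * edgeCount H →
                 ∀ {R} → Acc _⊂_ R → R ⊆ X → ∀ {k t} → (j ∸ 1) + (r ∸ 1) * ℓ ≤ t → t ≤ k →
                 #indep-with H R k ≤ (∣ R ∣ C t) * (u C (k ∸ t))

    bound-with-heavy : (H : Hypergraph (suc j) n) → EdgesWithin H X → p * m ^ suc j ≤ q * edgeCount H →
                       ∀ {R} → Acc _⊂_ R → R ⊆ X → ∀ {d} → d ∈ R → Heavy H d →
                       ∀ {k t} → j + (r ∸ 1) * ℓ ≤ t → t ≤ k →
                       #indep-with H R k ≤ (∣ R ∣ C t) * (u C (k ∸ t))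

    bound-with {zero} H _ dense _ _ _ _ = ≤-trans (≤-reflexive (#indep-with-0-uniform H dense _ _)) z≤n
    bound-with {suc j} H within dense {R} R-acc R⊆X {k} {t} t≥ t≤k with any? (λ w → w ∈? R ×-dec heavy? H w)
    ... | yes (d , d∈R , heavy) = bound-with-heavy H within dense R-acc R⊆X d∈R heavy t≥ t≤k
    ... | no no-heavy = begin
      #indep-with H R k             ≤⟨ #indep-with≤#indep H R k ⟩
      #indep R k                    ≤⟨ bound-ℓ R-shrunk (m+n≤o⇒n≤o j t≥) t≤k ⟩
      (∣ R ∣ C t) * (u C (k ∸ t))    ∎
      where
      open ≤-Reasoning
      R-shrunk : Shrunk ℓ ∣ R ∣
      R-shrunk = shrink-step {p = p} ℓ (∣R∣+#heavy≤m H R⊆X (λ w∈R heavy → no-heavy (_ , w∈R , heavy)))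
                                       (p*m≤q*#heavy H within dense) shrunk

    bound-with-heavy {zero} H within dense {R} (acc rec) R⊆X {d} d∈R heavy {k} {t} t≥ t≤k = begin
      #indep-with H R k                                       ≤⟨ #indep-with-split H d R k ⟩
      #indep-with H R' k + #indep-with (link H d) R' (k ∸ 1)  ≡⟨ cong (#indep-with H R' k +_) no-set-contains-d ⟩
      #indep-with H R' k + 0                                  ≡⟨ +-identityʳ _ ⟩
      #indep-with H R' k                                      ≤⟨ bound-with H within dense (rec R'⊂R) R'⊆X t≥ t≤k ⟩
      (∣ R' ∣ C t) * (u C (k ∸ t))                            ≤⟨ *-monoˡ-≤ (u C (k ∸ t)) (C-monoˡ-≤ t (p⊆q⇒∣p∣≤∣q∣ (p⊂q⇒p⊆q R'⊂R))) ⟩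
      (∣ R ∣ C t) * (u C (k ∸ t))                             ∎
      where
      open ≤-Reasoning
      R' = R ─ ⁅ d ⁆
      R'⊂R : R' ⊂ R
      R'⊂R = x∈p⇒p-x⊂p d∈R
      R'⊆X : R' ⊆ X
      R'⊆X = R⊆X ∘ p⊂q⇒p⊆q R'⊂R
      no-set-contains-d : #indep-with (link H d) R' (k ∸ 1) ≡ 0
      no-set-contains-d = #indep-with-0-uniform (link H d) (dense-link H heavy) R' (k ∸ 1)
    bound-with-heavy {suc j} H within dense {R} (acc rec) R⊆X {d} d∈R heavy {suc k} {suc t} t≥ t≤k = begin
      #indep-with H R (suc k)                                 ≤⟨ #indep-with-split H d R (suc k) ⟩
      #indep-with H R' (suc k) + #indep-with (link H d) R' k  ≤⟨ pascal-≤ ∣ R' ∣ t (u C (k ∸ t))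
                                                                   (bound-with H within dense (rec R'⊂R) R'⊆X t≥ t≤k)
                                                                   (bound-with (link H d) (link-within H d within) (dense-link H heavy)
                                                                               (rec R'⊂R) R'⊆X (≤-pred t≥) (≤-pred t≤k)) ⟩
      (suc ∣ R' ∣ C suc t) * (u C (k ∸ t))                    ≡⟨ cong (λ s → (s C suc t) * (u C (k ∸ t))) (sym (∣p∣≡1+∣p─⁅x⁆∣ d∈R)) ⟩
      (∣ R ∣ C suc t) * (u C (suc k ∸ suc t))                 ∎
      where
      open ≤-Reasoning
      R' = R ─ ⁅ d ⁆
      R'⊂R : R' ⊂ R
      R'⊂R = x∈p⇒p-x⊂p d∈R
      R'⊆X : R' ⊆ X
      R'⊆X = R⊆X ∘ p⊂q⇒p⊆q R'⊂R

  module _ (1≤u : 1 ≤ u) (2≤r : 2 ≤ r)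
           (min-degree : ∀ S → u < ∣ S ∣ → p * (∣ S ∣ ∸ 1) ^ (r ∸ 1) ≤ q * maxDegreeIn G S) where

    1≤r∸1 : 1 ≤ r ∸ 1
    1≤r∸1 = ∸-monoˡ-≤ 1 2≤r

    0<[s∸1]^[r∸1] : ∀ {s} → u < s → 0 < (s ∸ 1) ^ (r ∸ 1)
    0<[s∸1]^[r∸1] {s} u<s =
      subst (_≤ (s ∸ 1) ^ (r ∸ 1)) (^-zeroˡ (r ∸ 1)) (^-monoˡ-≤ (r ∸ 1) (∸-monoˡ-≤ 1 (≤-trans (s≤s 1≤u) u<s)))

    module InductionStep (ℓ : ℕ) (bound-ℓ : ∀ {S} → Shrunk ℓ ∣ S ∣ → Bound ℓ S) where

      bound-suc : ∀ {S} → Acc _⊂_ S → Shrunk (suc ℓ) ∣ S ∣ → Bound (suc ℓ) S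

      bound-large : ∀ {S} → Acc _⊂_ S → u < ∣ S ∣ → Shrunk (suc ℓ) ∣ S ∣ → Bound (suc ℓ) S

      bound-suc {S} S-acc shrunk t≥ t≤k =
        [ (λ ∣S∣≤u → small-bound ∣S∣≤u t≤k) , (λ u<∣S∣ → bound-large S-acc u<∣S∣ shrunk t≥ t≤k) ]′ (≤-<-connex ∣ S ∣ u)

      bound-large _ _ _ {t = zero} t≥ _ = contradiction t≥ (<⇒≱ (*-mono-≤ 1≤r∸1 (s≤s (z≤n {ℓ}))))
      bound-large _ _ _ {zero} {suc t} _ ()
      bound-large {S} (acc rec) u<∣S∣ shrunk {suc k} {suc t} t≥ (s≤s t≤k)
        with maxDegreeIn-attained G S (p*y≤q*x⇒0<x (0<[s∸1]^[r∸1] u<∣S∣) (min-degree S u<∣S∣))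
      ... | v , v∈S , max≡degree = begin
        #indep S (suc k)                         ≤⟨ #indep-split S v (suc k) ⟩
        #indep S' (suc k) + #indep-with L S' k   ≤⟨ pascal-≤ ∣ S' ∣ t (u C (k ∸ t))
                                                      (bound-suc (rec S'⊂S) shrunk' t≥ (s≤s t≤k))
                                                      (WithDenseHypergraph.bound-with ℓ bound-ℓ ≤-refl shrunk'
                                                         L (link-induced-within G S v) dense (⊂-wellFounded S') (λ x∈S' → x∈S')
                                                         ([a∸1]+a*ℓ≤t 1≤r∸1 t≥) t≤k) ⟩
        (suc ∣ S' ∣ C suc t) * (u C (k ∸ t))     ≡⟨ cong (λ s → (s C suc t) * (u C (k ∸ t))) (sym ∣S∣≡1+∣S'∣) ⟩
        (∣ S ∣ C suc t) * (u C (suc k ∸ suc t))  ∎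
        where
        open ≤-Reasoning
        S' = S ─ ⁅ v ⁆
        S'⊂S : S' ⊂ S
        S'⊂S = x∈p⇒p-x⊂p v∈S
        ∣S∣≡1+∣S'∣ : ∣ S ∣ ≡ suc ∣ S' ∣
        ∣S∣≡1+∣S'∣ = ∣p∣≡1+∣p─⁅x⁆∣ v∈S
        L = link (induced G S) v
        dense : p * ∣ S' ∣ ^ (r ∸ 1) ≤ q * edgeCount L
        dense = begin
          p * ∣ S' ∣ ^ (r ∸ 1)          ≡⟨ cong (λ s → p * (s ∸ 1) ^ (r ∸ 1)) (sym ∣S∣≡1+∣S'∣) ⟩
          p * (∣ S ∣ ∸ 1) ^ (r ∸ 1)     ≤⟨ min-degree S u<∣S∣ ⟩
          q * maxDegreeIn G S           ≡⟨ cong (q *_) (trans max≡degree (sym (edgeCount-link (induced G S) v))) ⟩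
          q * edgeCount L               ∎
        shrunk' : Shrunk (suc ℓ) ∣ S' ∣
        shrunk' = ≤-trans (*-monoʳ-≤ ((q ∸ p) ^ suc ℓ) (p⊆q⇒∣p∣≤∣q∣ (p⊂q⇒p⊆q S'⊂S))) shrunk

    bound : ∀ ℓ {S} → Shrunk ℓ ∣ S ∣ → Bound ℓ S
    bound zero    shrunk t≥ t≤k = small-bound (subst₂ _≤_ (*-identityˡ _) (*-identityˡ u) shrunk) t≤k
    bound (suc ℓ) shrunk        = InductionStep.bound-suc ℓ (bound ℓ) (⊂-wellFounded _) shrunk

lemma3p1 : (r ℓ k u n : ℕ) → 2 ≤ r → (r ∸ 1) * ℓ ≤ k → 1 ≤ u → 1 ≤ n
    → (ε : ℚ) → 0ℚ <ℚ ε → ε ≤ℚ 1ℚ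
    → ((1ℚ - ε) ^ℚ ℓ) *ℚ ℕtoℚ n ≤ℚ ℕtoℚ u
    → (G : Hypergraph r n)
    → (∀ (S : Subset n) → u < ∣ S ∣
         → ε *ℚ (ℕtoℚ (∣ S ∣ ∸ 1) ^ℚ (r ∸ 1)) ≤ℚ ℕtoℚ (maxDegreeIn G S))
    → numIndependent G k ≤ (n C ((r ∸ 1) * ℓ)) * (u C (k ∸ (r ∸ 1) * ℓ))
lemma3p1 r ℓ k u n 2≤r [r∸1]ℓ≤k 1≤u _ ε 0<ε ε≤1 shrunk G min-degree with as-fraction ε 0<ε ε≤1
... | p , q , 1≤p , p≤q , ε*q≡p = begin
  numIndependent G k                                     ≡⟨ numIndependent≡subsetCount G k ⟩
  subsetCount (independent? G) ⊤ k                      ≤⟨ IndependentSets.bound G u p q 1≤p p≤q 1≤u 2≤r min-degreeℕ ℓ shrunkℕ ≤-refl [r∸1]ℓ≤k ⟩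
  (∣ ⊤ {n} ∣ C ((r ∸ 1) * ℓ)) * (u C (k ∸ (r ∸ 1) * ℓ))  ≡⟨ cong (λ s → (s C ((r ∸ 1) * ℓ)) * (u C (k ∸ (r ∸ 1) * ℓ))) (∣⊤∣≡n n) ⟩
  (n C ((r ∸ 1) * ℓ)) * (u C (k ∸ (r ∸ 1) * ℓ))          ∎
  where
  open ≤-Reasoning
  min-degreeℕ : ∀ S → u < ∣ S ∣ → p * (∣ S ∣ ∸ 1) ^ (r ∸ 1) ≤ q * maxDegreeIn G S
  min-degreeℕ S u<∣S∣ = ε*x≤y⇒p*x≤q*y {ε = ε} p≤q ε*q≡p
    (subst (λ x → ε *ℚ x ≤ℚ ℕtoℚ (maxDegreeIn G S)) (sym (ℕtoℚ-^ (∣ S ∣ ∸ 1) (r ∸ 1))) (min-degree S u<∣S∣))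
  shrunkℕ : (q ∸ p) ^ ℓ * ∣ ⊤ {n} ∣ ≤ q ^ ℓ * u
  shrunkℕ = subst (λ s → (q ∸ p) ^ ℓ * s ≤ q ^ ℓ * u) (sym (∣⊤∣≡n n))
                  ([1-ε]^ℓ*x≤y⇒[q∸p]^ℓ*x≤q^ℓ*y {ε = ε} p≤q ε*q≡p ℓ shrunk)
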